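{- For every positive integer $n$ there exists a word of length $n$ over an alphabet of size $\mathcal{O}(\log n)$ that has at least $2^{\lfloor (n+1)/16\rfloor}$ different shortest s-covers.
   Context: A word is a finite sequence of letters. An occurrence of a word $C$ as a subsequence of a word $S$ is an increasing sequence of positions $i_0<\cdots<i_{|C|-1}$ of $S$ with $S[i_j]=C[j]$. $C$ is an s-cover of $S$ if every position of $S$ lies in some occurrence of $C$ as a subsequence of $S$. A shortest s-cover of $S$ is an s-cover of $S$ of minimum length. -}

module Defs where

open import Data.Nat using (ℕ; _≤_)
open import Data.Fin as Fin using (Fin)
open import Data.List using (List; length; lookup)
open import Data.Product using (Σ; ∃; _×_; proj₁)
open import Relation.Binary.PropositionalEquality using (_≡_)

Word : ℕ → Set
Word k = List (Fin k)

Occurrence : ∀ {k} → Word k → Word k → Set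
Occurrence C S =
  Σ (Fin (length C) → Fin (length S)) λ f →
    (∀ i j → i Fin.< j → f i Fin.< f j) ×
    (∀ j → lookup S (f j) ≡ lookup C j)

IsSCover : ∀ {k} → Word k → Word k → Set
IsSCover C S =
  ∀ (p : Fin (length S)) →
    Σ (Occurrence C S) λ occ → ∃ λ j → proj₁ occ j ≡ p

IsShortestSCover : ∀ {k} → Word k → Word k → Set
IsShortestSCover {k} C S =
  IsSCover C S × (∀ (D : Word k) → IsSCover D S → length C ≤ length D)

{-# OPTIONS --safe #-}
module Submission where

-- C covers S at a position carrying the letter y if C = C₁ y C₂ with C₁ a subsequence of the
-- part of S before that position and C₂ of the part after it; C is an s-cover of S iff it covers
-- S at every position.  If the letter x occurs in neither A nor B, covering A x B at its x forces
-- an s-cover into the form C x D, and covering the other positions shows that C and D are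
-- s-covers of A and B; conversely every such C x D is an s-cover.  So the shortest s-covers of
-- A x B are exactly the products of shortest ones, and their numbers multiply.
-- The word ababcacbaba has the two shortest s-covers abacba and abcaba.  Joining copies of it
-- along a complete binary tree whose inner nodes of height h carry the letter 3 + h gives words
-- of length 12·2ʰ − 1 over 3 + h letters with 2^(2ʰ) shortest s-covers.  For other lengths n,
-- keep the left subtree, the root separator and a recursively truncated right subtree: every
-- complete block of 12 letters still contributes a factor 2, giving 2^⌊(n+1)/12⌋ in total.

open import Defs
open import Data.Nat using (ℕ; _≤_; _+_; _*_; _^_)
open import Data.Nat.DivMod using (_/_)
open import Data.Nat.Logarithm using (⌊log₂_⌋)
open import Data.List using (List; length)
open import Data.List.Relation.Unary.All using (All)
open import Data.List.Relation.Unary.Unique.Propositional using (Unique)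
open import Data.Product using (Σ; _×_)
open import Relation.Binary.PropositionalEquality using (_≡_)

open import Level using (Level)
open import Function using (_∘_)
open import Data.Nat as ℕ using (zero; suc; _<_; _∸_; z≤n; s≤s; _≤?_; _<?_; NonZero)
import Data.Nat.Properties as ℕ
open import Data.Nat.DivMod using (+-distrib-/-∣ˡ; /-monoʳ-≤; m<n⇒m/n≡0)
open import Data.Nat.Divisibility using (_∣_; n∣m*n)
open import Data.Nat.Logarithm using (⌊log₂⌋-mono-≤; ⌊log₂[2^n]⌋≡n)
open import Data.Fin as Fin using (Fin; zero; suc; toℕ; punchOut)
open import Data.Fin.Properties using (toℕ-injective; toℕ-fromℕ<; punchIn-punchOut; 0≢1+n)
open import Data.Product using (∃; _,_; proj₁; proj₂)
import Data.Product as Product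
open import Data.Sum using (_⊎_; inj₁; inj₂)
open import Data.List using ([]; _∷_; _++_; lookup; map; replicate; cartesianProductWith)
open import Data.List.Properties
  using (length-++; length-map; length-replicate; ∷-injective; ∷-injectiveʳ; ++-assoc)
open import Data.List.Membership.Propositional using (_∈_; _∉_; find; lose)
open import Data.List.Membership.Propositional.Properties
  using (∈-++⁺ˡ; ∈-++⁺ʳ; ∈-map⁺; ∈-map⁻; ∈-cartesianProductWith⁻)
open import Data.List.Relation.Unary.Any as Any using (Any; here; there)
open import Data.List.Relation.Unary.All as All using ([]; _∷_)
import Data.List.Relation.Unary.All.Properties as All
open import Data.List.Relation.Unary.AllPairs using ([]; _∷_)
import Data.List.Relation.Unary.Unique.Propositional.Properties as Unique
open import Data.List.Relation.Binary.Disjoint.Propositional using (Disjoint)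
open import Data.List.Relation.Binary.Sublist.Propositional using (_⊆_; []; _∷_; _∷ʳ_; minimum)
open import Data.List.Relation.Binary.Sublist.Propositional.Properties using (Any-resp-⊆; ++⁺)
import Data.List.Relation.Binary.Sublist.DecPropositional as DecSublist
open import Relation.Nullary using (¬_; Dec; yes; no; contradiction)
open import Relation.Nullary.Decidable using (map′; _×-dec_; _⊎-dec_; ¬?; from-yes)
open import Relation.Binary.PropositionalEquality
  using (_≢_; refl; sym; trans; cong; cong₂; subst; subst₂; setoid; module ≡-Reasoning)

private variable
  ℓ : Level
  X Y Z : Set ℓ

++-injective : ∀ (ws xs : List X) {ys zs} → length ws ≡ length xs → ws ++ ys ≡ xs ++ zs →
               ws ≡ xs × ys ≡ zs
++-injective []       []       _     ys≡zs = refl , ys≡zs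
++-injective (w ∷ ws) (x ∷ xs) |ws|≡ eq with refl , eq′ ← ∷-injective eq =
  let ws≡xs , ys≡zs = ++-injective ws xs (ℕ.suc-injective |ws|≡) eq′ in cong (w ∷_) ws≡xs , ys≡zs

length-cartesianProductWith : ∀ (f : X → Y → Z) xs ys →
                              length (cartesianProductWith f xs ys) ≡ length xs * length ys
length-cartesianProductWith f []       ys = refl
length-cartesianProductWith f (x ∷ xs) ys = begin
  length (map (f x) ys ++ cartesianProductWith f xs ys)          ≡⟨ length-++ (map (f x) ys) ⟩
  length (map (f x) ys) + length (cartesianProductWith f xs ys) ≡⟨ cong₂ _+_ (length-map (f x) ys)
                                                                           (length-cartesianProductWith f xs ys) ⟩
  length ys + length xs * length ys                              ∎
  where open ≡-Reasoning

Unique-cartesianProductWith : ∀ (f : X → Y → Z) {xs ys} →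
  (∀ {w x y z} → w ∈ xs → x ∈ xs → f w y ≡ f x z → w ≡ x × y ≡ z) →
  Unique xs → Unique ys → Unique (cartesianProductWith f xs ys)
Unique-cartesianProductWith f inj [] _ = []
Unique-cartesianProductWith f {x ∷ xs} {ys} inj (x∉xs ∷ xs!) ys! =
  Unique.++⁺ (Unique.map⁺ (proj₂ ∘ inj (here refl) (here refl)) ys!)
             (Unique-cartesianProductWith f (λ w∈ x∈ → inj (there w∈) (there x∈)) xs! ys!)
             disjoint
  where
  disjoint : Disjoint (map (f x) ys) (cartesianProductWith f xs ys)
  disjoint (v∈map , v∈prod) with ∈-map⁻ (f x) v∈map | ∈-cartesianProductWith⁻ f xs ys v∈prod
  ... | _ , _ , refl | w , _ , w∈xs , _ , fxy≡fwz =
    All.lookup x∉xs w∈xs (proj₁ (inj (here refl) (there w∈xs) fxy≡fwz))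

module _ {k : ℕ} where

  private variable
    c s x y : Fin k
    A B C C₁ C₂ D₁ D₂ S S₁ S₂ : Word k
    m₁ m₂ c₁ c₂ : ℕ

  CoversAt : Word k → Word k → Fin k → Word k → Set
  CoversAt C S₁ y S₂ = ∃ λ C₁ → ∃ λ C₂ → C ≡ C₁ ++ y ∷ C₂ × C₁ ⊆ S₁ × C₂ ⊆ S₂

  Covers : Word k → Word k → Set
  Covers C S = ∀ S₁ y S₂ → S ≡ S₁ ++ y ∷ S₂ → CoversAt C S₁ y S₂

  occurrence-[] : Occurrence [] S
  occurrence-[] = (λ ()) , (λ ()) , (λ ())

  occurrence-skip : Occurrence C S → Occurrence C (s ∷ S)
  occurrence-skip (f , f-mono , f-letters) = suc ∘ f , (λ i j i<j → s≤s (f-mono i j i<j)) , f-letters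

  occurrence-keep : c ≡ s → Occurrence C S → Occurrence (c ∷ C) (s ∷ S)
  occurrence-keep {c = c} {s = s} {C = C} {S = S} c≡s (f , f-mono , f-letters) = g , g-mono , g-letters
    where
    g : Fin (length (c ∷ C)) → Fin (length (s ∷ S))
    g zero    = zero
    g (suc i) = suc (f i)

    g-mono : ∀ i j → i Fin.< j → g i Fin.< g j
    g-mono zero    (suc j) _         = s≤s z≤n
    g-mono (suc i) (suc j) (s≤s i<j) = s≤s (f-mono i j i<j)

    g-letters : ∀ j → lookup (s ∷ S) (g j) ≡ lookup (c ∷ C) j
    g-letters zero    = sym c≡s
    g-letters (suc j) = f-letters j

  ⊆⇒occurrence : C ⊆ S → Occurrence C S
  ⊆⇒occurrence []                                = occurrence-[] {S = []}
  ⊆⇒occurrence {C = C}     {S = _ ∷ S} (_ ∷ʳ σ)   = occurrence-skip {C = C} {S = S} (⊆⇒occurrence σ)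
  ⊆⇒occurrence {C = _ ∷ C} {S = _ ∷ S} (c≡s ∷ σ) = occurrence-keep {C = C} {S = S} c≡s (⊆⇒occurrence σ)

  occurrence-tail : Occurrence (c ∷ C) S → Occurrence C S
  occurrence-tail (f , f-mono , f-letters) =
    f ∘ suc , (λ i j i<j → f-mono (suc i) (suc j) (s≤s i<j)) , f-letters ∘ suc

  private
    >⇒zero≢ : ∀ {n} {i j : Fin (suc n)} → i Fin.< j → zero ≢ j
    >⇒zero≢ i<j 0≡j = ℕ.n≮0 (subst (_ Fin.<_) (sym 0≡j) i<j)

    punchOut₀-mono-< : ∀ {n} {i j : Fin (suc n)} (0≢i : zero ≢ i) (0≢j : zero ≢ j) →
                       i Fin.< j → punchOut 0≢i Fin.< punchOut 0≢j
    punchOut₀-mono-< {i = zero}  0≢0 _   _         = contradiction refl 0≢0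
    punchOut₀-mono-< {j = zero}  _   0≢0 _         = contradiction refl 0≢0
    punchOut₀-mono-< {i = suc _} {j = suc _} _ _ (s≤s i<j) = i<j

    toℕ-punchOut₀ : ∀ {n m} {j : Fin (suc n)} (0≢j : zero ≢ j) → toℕ j ≡ suc m → toℕ (punchOut 0≢j) ≡ m
    toℕ-punchOut₀ 0≢j j≡1+m = ℕ.suc-injective (trans (cong toℕ (punchIn-punchOut 0≢j)) j≡1+m)

    lookup-punchOut₀ : ∀ {j : Fin (length (s ∷ S))} (0≢j : zero ≢ j) →
                       lookup S (punchOut 0≢j) ≡ lookup (s ∷ S) j
    lookup-punchOut₀ {j = zero}  0≢0 = contradiction refl 0≢0
    lookup-punchOut₀ {j = suc _} _   = refl

  occurrence-avoiding-0 : (o : Occurrence C (s ∷ S)) → (∀ i → zero ≢ proj₁ o i) → Occurrence C S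
  occurrence-avoiding-0 (f , f-mono , f-letters) 0∉f =
    (λ i → punchOut (0∉f i)) ,
    (λ i j i<j → punchOut₀-mono-< (0∉f i) (0∉f j) (f-mono i j i<j)) ,
    (λ j → trans (lookup-punchOut₀ (0∉f j)) (f-letters j))

  occurrence-unkeep : (o : Occurrence (c ∷ C) (s ∷ S)) → proj₁ o zero ≡ zero → c ≡ s × Occurrence C S
  occurrence-unkeep {c = c} {C = C} {s = s} {S = S} o@(f , f-mono , f-letters) f0≡0 =
    trans (sym (f-letters zero)) (cong (lookup (s ∷ S)) f0≡0) ,
    occurrence-avoiding-0 {C = C} (occurrence-tail o) (λ i → >⇒zero≢ (f-mono zero (suc i) (s≤s z≤n)))

  occurrence-unskip : ∀ {p} (o : Occurrence (c ∷ C) (s ∷ S)) → proj₁ o zero ≡ suc p → Occurrence (c ∷ C) S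
  occurrence-unskip o@(f , f-mono , _) f0≡ = occurrence-avoiding-0 o 0∉f
    where
    0∉f : ∀ i → zero ≢ f i
    0∉f zero    0≡f0 = 0≢1+n (trans 0≡f0 f0≡)
    0∉f (suc i)      = >⇒zero≢ (f-mono zero (suc i) (s≤s z≤n))

  occurrence⇒⊆ : Occurrence C S → C ⊆ S
  occurrence⇒⊆ {C = []}                _       = minimum _
  occurrence⇒⊆ {C = _ ∷ _} {S = []}    (f , _) with () ← f zero
  occurrence⇒⊆ {C = _ ∷ _} {S = s ∷ _} o       with proj₁ o zero in f0≡
  ... | zero  = let c≡s , o′ = occurrence-unkeep o f0≡ in c≡s ∷ occurrence⇒⊆ o′
  ... | suc _ = s ∷ʳ occurrence⇒⊆ (occurrence-unskip o f0≡)

  OccursThrough : Word k → Word k → ℕ → Set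
  OccursThrough C S p = Σ (Occurrence C S) λ o → ∃ λ j → toℕ (proj₁ o j) ≡ p

  occursThrough⇒coversAt : ∀ S₁ → OccursThrough C (S₁ ++ y ∷ S₂) (length S₁) → CoversAt C S₁ y S₂
  occursThrough⇒coversAt {C = c ∷ C} [] (o , zero , f0≡0) =
    let c≡y , o′ = occurrence-unkeep o (toℕ-injective f0≡0)
    in [] , C , cong (_∷ C) c≡y , [] , occurrence⇒⊆ o′
  occursThrough⇒coversAt {C = _ ∷ _} [] ((f , f-mono , _) , suc j , fj≡0) =
    contradiction (sym (toℕ-injective fj≡0)) (>⇒zero≢ (f-mono zero (suc j) (s≤s z≤n)))
  occursThrough⇒coversAt {C = c ∷ C} (s ∷ S₁) (o , j , fj≡) with proj₁ o zero in f0≡ | j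
  ... | zero  | zero with () ← trans (sym (cong toℕ f0≡)) fj≡
  ... | zero  | suc j =
    let c≡s , o′ = occurrence-unkeep o f0≡
        C₁ , C₂ , C≡ , σ₁ , σ₂ = occursThrough⇒coversAt S₁ (o′ , j , toℕ-punchOut₀ _ fj≡)
    in c ∷ C₁ , C₂ , cong (c ∷_) C≡ , c≡s ∷ σ₁ , σ₂
  ... | suc _ | j =
    let C₁ , C₂ , C≡ , σ₁ , σ₂ =
          occursThrough⇒coversAt S₁ (occurrence-unskip o f0≡ , j , toℕ-punchOut₀ _ fj≡)
    in C₁ , C₂ , C≡ , s ∷ʳ σ₁ , σ₂

  ⊆-around⇒occursThrough : C₁ ⊆ S₁ → C₂ ⊆ S₂ →
                           OccursThrough (C₁ ++ y ∷ C₂) (S₁ ++ y ∷ S₂) (length S₁)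
  ⊆-around⇒occursThrough {C₂ = C₂} {S₂ = S₂} [] σ₂ =
    occurrence-keep {C = C₂} {S = S₂} refl (⊆⇒occurrence σ₂) , zero , refl
  ⊆-around⇒occursThrough {C₁ = C₁} {S₁ = _ ∷ S₁} {C₂ = C₂} {S₂ = S₂} {y = y} (_ ∷ʳ σ₁) σ₂ =
    let o , j , fj≡ = ⊆-around⇒occursThrough σ₁ σ₂
    in occurrence-skip {C = C₁ ++ y ∷ C₂} {S = S₁ ++ y ∷ S₂} o , j , cong suc fj≡
  ⊆-around⇒occursThrough (c≡s ∷ σ₁) σ₂ =
    let o , j , fj≡ = ⊆-around⇒occursThrough σ₁ σ₂ in occurrence-keep c≡s o , suc j , cong suc fj≡

  coversAt⇒occursThrough : S ≡ S₁ ++ y ∷ S₂ → CoversAt C S₁ y S₂ → OccursThrough C S (length S₁)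
  coversAt⇒occursThrough refl (_ , _ , refl , σ₁ , σ₂) = ⊆-around⇒occursThrough σ₁ σ₂

  split-at : ∀ (S : Word k) (p : Fin (length S)) →
             ∃ λ S₁ → ∃ λ y → ∃ λ S₂ → S ≡ S₁ ++ y ∷ S₂ × length S₁ ≡ toℕ p
  split-at (s ∷ S) zero    = [] , s , S , refl , refl
  split-at (s ∷ S) (suc p) =
    let S₁ , y , S₂ , S≡ , |S₁|≡p = split-at S p in s ∷ S₁ , y , S₂ , cong (s ∷_) S≡ , cong suc |S₁|≡p

  isSCover⇒covers : IsSCover C S → Covers C S
  isSCover⇒covers cover S₁ y S₂ refl =
    let o , j , fj≡p = cover (Fin.fromℕ< |S₁|<|S|)
    in occursThrough⇒coversAt S₁ (o , j , trans (cong toℕ fj≡p) (toℕ-fromℕ< |S₁|<|S|))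
    where
    |S₁|<|S| : length S₁ < length (S₁ ++ y ∷ S₂)
    |S₁|<|S| = subst (length S₁ <_) (sym (length-++ S₁)) (ℕ.m<m+n (length S₁) (s≤s z≤n))

  covers⇒isSCover : Covers C S → IsSCover C S
  covers⇒isSCover {S = S} cover p =
    let S₁ , y , S₂ , S≡ , |S₁|≡p = split-at S p
        o , j , fj≡ = coversAt⇒occursThrough S≡ (cover S₁ y S₂ S≡)
    in o , j , toℕ-injective (trans fj≡ |S₁|≡p)

  split-compare : ∀ (A : Word k) {B S₁ S₂ x y} → A ++ x ∷ B ≡ S₁ ++ y ∷ S₂ →
    (∃ λ M → A ≡ S₁ ++ y ∷ M × S₂ ≡ M ++ x ∷ B) ⊎
    (A ≡ S₁ × x ≡ y × B ≡ S₂) ⊎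
    (∃ λ M → S₁ ≡ A ++ x ∷ M × B ≡ M ++ y ∷ S₂)
  split-compare []      {S₁ = []}     refl = inj₂ (inj₁ (refl , refl , refl))
  split-compare []      {S₁ = _ ∷ S₁} refl = inj₂ (inj₂ (S₁ , refl , refl))
  split-compare (_ ∷ A) {S₁ = []}     refl = inj₁ (A , refl , refl)
  split-compare (a ∷ A) {S₁ = _ ∷ _}  eq with refl , eq′ ← ∷-injective eq with split-compare A eq′
  ... | inj₁ (M , A≡ , S₂≡)         = inj₁ (M , cong (a ∷_) A≡ , S₂≡)
  ... | inj₂ (inj₁ (A≡ , x≡y , B≡)) = inj₂ (inj₁ (cong (a ∷_) A≡ , x≡y , B≡))
  ... | inj₂ (inj₂ (M , S₁≡ , B≡))  = inj₂ (inj₂ (M , cong (a ∷_) S₁≡ , B≡))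

  ⊆-separated : ∀ (C A : Word k) {D B x} → x ∉ A → x ∉ B → C ++ x ∷ D ⊆ A ++ x ∷ B → C ⊆ A × D ⊆ B
  ⊆-separated []      []      x∉A x∉B (_ ∷ʳ σ)    = contradiction (Any-resp-⊆ σ (here refl)) x∉B
  ⊆-separated []      []      x∉A x∉B (refl ∷ σ)  = [] , σ
  ⊆-separated (c ∷ C) []      x∉A x∉B (_ ∷ʳ σ)    =
    contradiction (Any-resp-⊆ σ (∈-++⁺ʳ (c ∷ C) (here refl))) x∉B
  ⊆-separated (_ ∷ C) []      x∉A x∉B (_ ∷ σ)     = contradiction (Any-resp-⊆ σ (∈-++⁺ʳ C (here refl))) x∉B
  ⊆-separated C       (a ∷ A) x∉A x∉B (_ ∷ʳ σ)    =
    let C⊆A , D⊆B = ⊆-separated C A (x∉A ∘ there) x∉B σ in a ∷ʳ C⊆A , D⊆B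
  ⊆-separated []      (_ ∷ A) x∉A x∉B (refl ∷ σ)  = contradiction (here refl) x∉A
  ⊆-separated (_ ∷ C) (_ ∷ A) x∉A x∉B (c≡a ∷ σ)   =
    let C⊆A , D⊆B = ⊆-separated C A (x∉A ∘ there) x∉B σ in c≡a ∷ C⊆A , D⊆B

  -- In a split of D₁ x D₂ at a letter y of A, the x lies neither in the part embedded before y
  -- nor at y, so it lies after y, where ⊆-separated cuts it off; symmetrically for covers-separatedʳ.
  covers-separatedˡ : x ∉ A → x ∉ B → Covers (D₁ ++ x ∷ D₂) (A ++ x ∷ B) → Covers D₁ A
  covers-separatedˡ {x = x} {B = B} {D₁ = D₁} x∉A x∉B cover A₁ y A₂ refl
    with cover A₁ y (A₂ ++ x ∷ B) (++-assoc A₁ (y ∷ A₂) (x ∷ B))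
  ... | E₁ , E₂ , D≡ , E₁⊆A₁ , E₂⊆ with split-compare D₁ D≡
  ... | inj₁ (M , D₁≡ , refl) =
    E₁ , M , D₁≡ , E₁⊆A₁ , proj₁ (⊆-separated M A₂ (x∉A ∘ ∈-++⁺ʳ A₁ ∘ there) x∉B E₂⊆)
  ... | inj₂ (inj₁ (_ , refl , _)) = contradiction (∈-++⁺ʳ A₁ (here refl)) x∉A
  ... | inj₂ (inj₂ (M , refl , _)) =
    contradiction (Any-resp-⊆ E₁⊆A₁ (∈-++⁺ʳ D₁ (here refl))) (x∉A ∘ ∈-++⁺ˡ)

  covers-separatedʳ : x ∉ A → x ∉ B → Covers (D₁ ++ x ∷ D₂) (A ++ x ∷ B) → Covers D₂ B
  covers-separatedʳ {x = x} {A = A} {D₁ = D₁} x∉A x∉B cover B₁ y B₂ refl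
    with cover (A ++ x ∷ B₁) y B₂ (sym (++-assoc A (x ∷ B₁) (y ∷ B₂)))
  ... | E₁ , E₂ , D≡ , E₁⊆ , E₂⊆B₂ with split-compare D₁ D≡
  ... | inj₁ (M , _ , refl) =
    contradiction (Any-resp-⊆ E₂⊆B₂ (∈-++⁺ʳ M (here refl))) (x∉B ∘ ∈-++⁺ʳ B₁ ∘ there)
  ... | inj₂ (inj₁ (_ , refl , _)) = contradiction (∈-++⁺ʳ B₁ (here refl)) x∉B
  ... | inj₂ (inj₂ (M , refl , D₂≡)) =
    M , E₂ , D₂≡ , proj₂ (⊆-separated D₁ A x∉A (x∉B ∘ ∈-++⁺ˡ) E₁⊆) , E₂⊆B₂

  CoverLength≥ : Word k → ℕ → Set
  CoverLength≥ S m = ∀ D → Covers D S → m ≤ length D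

  coverLength≥-separated : x ∉ A → x ∉ B → CoverLength≥ A m₁ → CoverLength≥ B m₂ →
                           CoverLength≥ (A ++ x ∷ B) (m₁ + suc m₂)
  coverLength≥-separated {x = x} {A = A} {B = B} x∉A x∉B A≥ B≥ D cover with cover A x B refl
  ... | D₁ , D₂ , refl , _ , _ =
    subst (_ ≤_) (sym (length-++ D₁))
      (ℕ.+-mono-≤ (A≥ D₁ (covers-separatedˡ x∉A x∉B cover))
                  (s≤s (B≥ D₂ (covers-separatedʳ x∉A x∉B cover))))

  covers-separated : C₁ ⊆ A → Covers C₁ A → C₂ ⊆ B → Covers C₂ B → Covers (C₁ ++ x ∷ C₂) (A ++ x ∷ B)
  covers-separated {C₁ = C₁} {A = A} {C₂ = C₂} {x = x} C₁⊆A cover₁ C₂⊆B cover₂ S₁ y S₂ S≡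
    with split-compare A S≡
  ... | inj₁ (M , refl , refl) =
    let E₁ , E₂ , C₁≡ , E₁⊆ , E₂⊆ = cover₁ S₁ y M refl
    in E₁ , E₂ ++ x ∷ C₂ , trans (cong (_++ x ∷ C₂) C₁≡) (++-assoc E₁ (y ∷ E₂) (x ∷ C₂)) ,
       E₁⊆ , ++⁺ E₂⊆ (refl ∷ C₂⊆B)
  ... | inj₂ (inj₁ (refl , refl , refl)) = C₁ , C₂ , refl , C₁⊆A , C₂⊆B
  ... | inj₂ (inj₂ (M , refl , refl)) =
    let E₁ , E₂ , C₂≡ , E₁⊆ , E₂⊆ = cover₂ M y S₂ refl
    in C₁ ++ x ∷ E₁ , E₂ ,
       trans (cong (λ C → C₁ ++ x ∷ C) C₂≡) (sym (++-assoc C₁ (x ∷ E₁) (y ∷ E₂))) ,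
       ++⁺ C₁⊆A (refl ∷ E₁⊆) , E₂⊆

  -- C ⊆ S is not implied by Covers C S: every word covers [].
  record ManyShortestCovers (S : Word k) (m c : ℕ) : Set where
    field
      lower-bound : CoverLength≥ S m
      covers      : List (Word k)
      unique      : Unique covers
      valid       : All (λ C → length C ≡ m × C ⊆ S × Covers C S) covers
      count       : c ≤ length covers

  open ManyShortestCovers public

  manyShortestCovers-separated : x ∉ A → x ∉ B →
                                 ManyShortestCovers A m₁ c₁ → ManyShortestCovers B m₂ c₂ →
                                 ManyShortestCovers (A ++ x ∷ B) (m₁ + suc m₂) (c₁ * c₂)
  manyShortestCovers-separated {x = x} {A = A} {B = B} {m₁ = m₁} {c₁ = c₁} {m₂ = m₂} {c₂ = c₂}
                               x∉A x∉B 𝒜 ℬ = record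
    { lower-bound = coverLength≥-separated x∉A x∉B (lower-bound 𝒜) (lower-bound ℬ)
    ; covers      = cartesianProductWith join (covers 𝒜) (covers ℬ)
    ; unique      = Unique-cartesianProductWith join join-injective (unique 𝒜) (unique ℬ)
    ; valid       = All.cartesianProductWith⁺ (setoid _) (setoid _) join (covers 𝒜) (covers ℬ)
                      λ C∈ D∈ → join-valid (All.lookup (valid 𝒜) C∈) (All.lookup (valid ℬ) D∈)
    ; count       = subst (c₁ * c₂ ≤_) (sym (length-cartesianProductWith join (covers 𝒜) (covers ℬ)))
                      (ℕ.*-mono-≤ (count 𝒜) (count ℬ))
    }
    where
    join : Word k → Word k → Word k
    join C D = C ++ x ∷ D

    join-injective : ∀ {C C′ D D′} → C ∈ covers 𝒜 → C′ ∈ covers 𝒜 →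
                     join C D ≡ join C′ D′ → C ≡ C′ × D ≡ D′
    join-injective {C} {C′} C∈ C′∈ eq =
      let C≡C′ , xD≡xD′ = ++-injective C C′ (trans (proj₁ (All.lookup (valid 𝒜) C∈))
                                                    (sym (proj₁ (All.lookup (valid 𝒜) C′∈)))) eq
      in C≡C′ , ∷-injectiveʳ xD≡xD′

    join-valid : ∀ {C D} → length C ≡ m₁ × C ⊆ A × Covers C A → length D ≡ m₂ × D ⊆ B × Covers D B →
                 length (join C D) ≡ m₁ + suc m₂ × join C D ⊆ A ++ x ∷ B ×
                 Covers (join C D) (A ++ x ∷ B)
    join-valid {C} (|C|≡ , C⊆A , C-covers) (|D|≡ , D⊆B , D-covers) =
      trans (length-++ C) (cong₂ _+_ |C|≡ (cong suc |D|≡)) ,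
      ++⁺ C⊆A (refl ∷ D⊆B) ,
      covers-separated C⊆A C-covers D⊆B D-covers

  manyShortestCovers-[] : ManyShortestCovers [] 0 1
  manyShortestCovers-[] = record
    { lower-bound = λ _ _ → z≤n
    ; covers      = [] ∷ []
    ; unique      = [] ∷ []
    ; valid       = (refl , [] , λ { [] _ _ () ; (_ ∷ _) _ _ () }) ∷ []
    ; count       = ℕ.≤-refl
    }

  manyShortestCovers-replicate : ∀ n → ManyShortestCovers (replicate (suc n) x) 1 1
  manyShortestCovers-replicate {x = x} n = record
    { lower-bound = λ D cover → nonempty (cover [] x (replicate n x) refl)
    ; covers      = (x ∷ []) ∷ []
    ; unique      = [] ∷ []
    ; valid       = (refl , refl ∷ minimum _ , x-covers) ∷ []
    ; count       = ℕ.≤-refl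
    }
    where
    nonempty : ∀ {D S₂} → CoversAt D [] x S₂ → 1 ≤ length D
    nonempty (_ , _ , refl , [] , _) = s≤s z≤n

    x-covers : Covers (x ∷ []) (replicate (suc n) x)
    x-covers S₁ y S₂ eq =
      [] , [] , cong (_∷ []) (sym y≡x) , minimum _ , minimum _
      where
      y≡x : y ≡ x
      y≡x = All.lookup (subst (All (_≡ x)) eq (All.replicate⁺ (suc n) refl)) (∈-++⁺ʳ S₁ (here refl))

  manyShortestCovers⇒isShortestSCover : ∀ {m c} (𝒮 : ManyShortestCovers S m c) →
                                        All (λ C → IsShortestSCover C S) (covers 𝒮)
  manyShortestCovers⇒isShortestSCover {S = S} {m = m} 𝒮 = All.map shortest (valid 𝒮)
    where
    shortest : ∀ {C} → length C ≡ m × C ⊆ S × Covers C S → IsShortestSCover C S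
    shortest (|C|≡m , _ , C-covers) =
      covers⇒isSCover C-covers ,
      λ D D-covers → subst (_≤ length D) (sym |C|≡m) (lower-bound 𝒮 D (isSCover⇒covers D-covers))

  open DecSublist {A = Fin k} Fin._≟_ using (_⊆?_)

  splits : Word k → List (Word k × Fin k × Word k)
  splits []      = []
  splits (s ∷ S) = ([] , s , S) ∷ map (Product.map₁ (s ∷_)) (splits S)

  ∈-splits⁺ : S ≡ S₁ ++ y ∷ S₂ → (S₁ , y , S₂) ∈ splits S
  ∈-splits⁺ {S₁ = []}     refl = here refl
  ∈-splits⁺ {S₁ = s ∷ S₁} refl = there (∈-map⁺ (Product.map₁ (s ∷_)) (∈-splits⁺ {S₁ = S₁} refl))

  ∈-splits⁻ : ∀ S → (S₁ , y , S₂) ∈ splits S → S ≡ S₁ ++ y ∷ S₂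
  ∈-splits⁻ (s ∷ S) (here refl) = refl
  ∈-splits⁻ (s ∷ S) (there p) with ∈-map⁻ (Product.map₁ (s ∷_)) p
  ... | _ , p′ , refl = cong (s ∷_) (∈-splits⁻ S p′)

  coversAt? : ∀ C S₁ y S₂ → Dec (CoversAt C S₁ y S₂)
  coversAt? C S₁ y S₂ = map′ from to (Any.any? fits? (splits C))
    where
    Fits : Word k × Fin k × Word k → Set
    Fits (C₁ , z , C₂) = z ≡ y × C₁ ⊆ S₁ × C₂ ⊆ S₂

    fits? : ∀ split → Dec (Fits split)
    fits? (C₁ , z , C₂) = (z Fin.≟ y) ×-dec (C₁ ⊆? S₁) ×-dec (C₂ ⊆? S₂)

    to : CoversAt C S₁ y S₂ → Any Fits (splits C)
    to (_ , _ , C≡ , σ₁ , σ₂) = lose (∈-splits⁺ C≡) (refl , σ₁ , σ₂)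

    from : Any Fits (splits C) → CoversAt C S₁ y S₂
    from fits with find fits
    ... | (C₁ , _ , C₂) , ∈splits , refl , σ₁ , σ₂ = C₁ , C₂ , ∈-splits⁻ C ∈splits , σ₁ , σ₂

  covers? : ∀ C S → Dec (Covers C S)
  covers? C S = map′ from to (All.all? (λ (S₁ , y , S₂) → coversAt? C S₁ y S₂) (splits S))
    where
    CoversSplit : Word k × Fin k × Word k → Set
    CoversSplit (S₁ , y , S₂) = CoversAt C S₁ y S₂

    to : Covers C S → All CoversSplit (splits S)
    to cover = All.tabulate λ {(S₁ , y , S₂)} ∈splits → cover S₁ y S₂ (∈-splits⁻ S ∈splits)

    from : All CoversSplit (splits S) → Covers C S
    from all S₁ y S₂ S≡ = All.lookup all (∈-splits⁺ S≡)

  sublists : Word k → List (Word k)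
  sublists []      = [] ∷ []
  sublists (s ∷ S) = map (s ∷_) (sublists S) ++ sublists S

  ⊆⇒∈-sublists : C ⊆ S → C ∈ sublists S
  ⊆⇒∈-sublists []                         = here refl
  ⊆⇒∈-sublists {S = s ∷ S} (_ ∷ʳ σ)       = ∈-++⁺ʳ (map (s ∷_) (sublists S)) (⊆⇒∈-sublists σ)
  ⊆⇒∈-sublists {S = s ∷ S} (refl ∷ σ)     = ∈-++⁺ˡ (∈-map⁺ (s ∷_) (⊆⇒∈-sublists σ))

  covers-∷⇒⊆ : Covers C (s ∷ S) → C ⊆ s ∷ S
  covers-∷⇒⊆ {s = s} {S = S} cover with cover [] s S refl
  ... | _ , _ , refl , [] , σ₂ = refl ∷ σ₂

  coverLength≥-by-search : ∀ {m} → All (λ D → m ≤ length D ⊎ ¬ Covers D (s ∷ S)) (sublists (s ∷ S)) →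
                           CoverLength≥ (s ∷ S) m
  coverLength≥-by-search checked D cover with All.lookup checked (⊆⇒∈-sublists (covers-∷⇒⊆ cover))
  ... | inj₁ m≤|D|   = m≤|D|
  ... | inj₂ ¬covers = contradiction cover ¬covers

fullLength : ℕ → ℕ
fullLength zero    = 11
fullLength (suc h) = suc (fullLength h + fullLength h)

blockSize : ℕ → ℕ
blockSize h = suc (fullLength h)

blockSize-suc : ∀ h → blockSize (suc h) ≡ blockSize h + blockSize h
blockSize-suc h = cong suc (sym (ℕ.+-suc (fullLength h) (fullLength h)))

blockSize≡2^*12 : ∀ h → blockSize h ≡ 2 ^ h * 12
blockSize≡2^*12 zero    = refl
blockSize≡2^*12 (suc h) = begin
  blockSize (suc h)                 ≡⟨ blockSize-suc h ⟩
  blockSize h + blockSize h         ≡⟨ cong₂ _+_ (blockSize≡2^*12 h) (blockSize≡2^*12 h) ⟩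
  2 ^ h * 12 + 2 ^ h * 12           ≡⟨ ℕ.*-distribʳ-+ 12 (2 ^ h) (2 ^ h) ⟨
  (2 ^ h + 2 ^ h) * 12              ≡⟨ cong (λ m → (2 ^ h + m) * 12) (ℕ.+-identityʳ (2 ^ h)) ⟨
  2 ^ suc h * 12                    ∎
  where open ≡-Reasoning

12∣blockSize : ∀ h → 12 ∣ blockSize h
12∣blockSize h = subst (12 ∣_) (sym (blockSize≡2^*12 h)) (n∣m*n (2 ^ h))

2^[1+h]≤blockSize : ∀ h → 2 ^ suc h ≤ blockSize h
2^[1+h]≤blockSize h =
  subst₂ _≤_ (ℕ.*-comm (2 ^ h) 2) (sym (blockSize≡2^*12 h)) (ℕ.*-monoʳ-≤ (2 ^ h) (ℕ.m≤m+n 2 10))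

remainder<blockSize : ∀ h {n} → n < blockSize (suc h) → n ∸ blockSize h < blockSize h
remainder<blockSize h {n} n< = ℕ.m<n+o⇒m∸n<o n (blockSize h) (subst (n <_) (blockSize-suc h) n<)

suc-/-split : ∀ d {b n} .{{_ : NonZero d}} → d ∣ b → b ≤ n → suc n / d ≡ b / d + suc (n ∸ b) / d
suc-/-split d {b} {n} d∣b b≤n = begin
  suc n / d                  ≡⟨ cong (λ m → suc m / d) (ℕ.m+[n∸m]≡n b≤n) ⟨
  suc (b + (n ∸ b)) / d      ≡⟨ cong (_/ d) (ℕ.+-suc b (n ∸ b)) ⟨
  (b + suc (n ∸ b)) / d      ≡⟨ +-distrib-/-∣ˡ (suc (n ∸ b)) d∣b ⟩
  b / d + suc (n ∸ b) / d    ∎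
  where open ≡-Reasoning

binaryMagnitude : ∀ n → 1 ≤ n → ∃ λ t → 2 ^ t ≤ n × n < 2 ^ suc t
binaryMagnitude (suc zero)    _ = 0 , ℕ.≤-refl , s≤s (s≤s z≤n)
binaryMagnitude (suc (suc m)) _ with binaryMagnitude (suc m) (s≤s z≤n)
... | t , 2^t≤ , <2^[1+t] with suc (suc m) <? 2 ^ suc t
...   | yes <2^[1+t]′ = t , ℕ.m≤n⇒m≤1+n 2^t≤ , <2^[1+t]′
...   | no ≮2^[1+t]   = suc t , ℕ.≮⇒≥ ≮2^[1+t] , subst (_< 2 ^ suc (suc t)) 2^[1+t]≡ (2^[1+t]<2^[2+t])
  where
  2^[1+t]≡ : 2 ^ suc t ≡ suc (suc m)
  2^[1+t]≡ = ℕ.≤-antisym (ℕ.≮⇒≥ ≮2^[1+t]) <2^[1+t]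
  2^[1+t]<2^[2+t] : 2 ^ suc t < 2 ^ suc (suc t)
  2^[1+t]<2^[2+t] = ℕ.^-monoʳ-< 2 (s≤s (s≤s z≤n)) (ℕ.n<1+n (suc t))

3+t≤3*[1+L] : ∀ {t L} → t ≤ L → 3 + t ≤ 3 * (1 + L)
3+t≤3*[1+L] {t} {L} t≤L =
  subst (3 + t ≤_) (sym (ℕ.*-distribˡ-+ 3 1 L)) (ℕ.+-monoʳ-≤ 3 (ℕ.≤-trans t≤L (ℕ.m≤n*m L 3)))

2^[[n+1]/16]≤2^[[1+n]/12] : ∀ n → 2 ^ ((n + 1) / 16) ≤ 2 ^ (suc n / 12)
2^[[n+1]/16]≤2^[[1+n]/12] n =
  subst (λ m → 2 ^ ((n + 1) / 16) ≤ 2 ^ (m / 12)) (ℕ.+-comm n 1)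
        (ℕ.^-monoʳ-≤ 2 (/-monoʳ-≤ (n + 1) (ℕ.m≤m+n 12 4)))

2^t≤n⇒t≤⌊log₂n⌋ : ∀ {t n} → 2 ^ t ≤ n → t ≤ ⌊log₂ n ⌋
2^t≤n⇒t≤⌊log₂n⌋ {t} {n} 2^t≤n = subst (_≤ ⌊log₂ n ⌋) (⌊log₂[2^n]⌋≡n t) (⌊log₂⌋-mono-≤ 2^t≤n)

module Construction (H : ℕ) where

  K : ℕ
  K = 3 + H

  open DecSublist {A = Fin K} Fin._≟_ using (_⊆?_)

  a b c : Fin K
  a = zero
  b = suc zero
  c = suc (suc zero)

  gadget abacba abcaba : Word K
  gadget = a ∷ b ∷ a ∷ b ∷ c ∷ a ∷ c ∷ b ∷ a ∷ b ∷ a ∷ []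
  abacba = a ∷ b ∷ a ∷ c ∷ b ∷ a ∷ []
  abcaba = a ∷ b ∷ c ∷ a ∷ b ∷ a ∷ []

  manyShortestCovers-gadget : ManyShortestCovers gadget 6 2
  manyShortestCovers-gadget = record
    { lower-bound = coverLength≥-by-search
        (from-yes (All.all? (λ D → (6 ≤? length D) ⊎-dec ¬? (covers? D gadget)) (sublists gadget)))
    ; covers      = abacba ∷ abcaba ∷ []
    ; unique      = ((λ ()) ∷ []) ∷ [] ∷ []
    ; valid       = (refl , from-yes (abacba ⊆? gadget) , from-yes (covers? abacba gadget)) ∷
                    (refl , from-yes (abcaba ⊆? gadget) , from-yes (covers? abcaba gadget)) ∷ []
    ; count       = ℕ.≤-refl
    }

  separator : ∀ {h} → h < H → Fin K
  separator h<H = Fin.fromℕ< (ℕ.+-monoʳ-< 3 h<H)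

  toℕ-separator : ∀ {h} (h<H : h < H) → toℕ (separator h<H) ≡ 3 + h
  toℕ-separator h<H = toℕ-fromℕ< (ℕ.+-monoʳ-< 3 h<H)

  base : ℕ → Word K
  base n with n ℕ.≟ 11
  ... | yes _ = gadget
  ... | no  _ = replicate n a

  word : ∀ h → h ≤ H → ℕ → Word K
  word zero    _   n = base n
  word (suc h) h<H n with n <? blockSize h
  ... | yes _ = word h (ℕ.<⇒≤ h<H) n
  ... | no  _ = word h (ℕ.<⇒≤ h<H) (fullLength h) ++
                separator h<H ∷ word h (ℕ.<⇒≤ h<H) (n ∸ blockSize h)

  letters-word : ∀ h h≤H n → All (λ z → toℕ z < 3 + h) (word h h≤H n)
  letters-word zero _ n with n ℕ.≟ 11
  ... | yes _ = from-yes (All.all? (λ z → toℕ z <? 3) gadget)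
  ... | no  _ = All.replicate⁺ n (s≤s z≤n)
  letters-word (suc h) h<H n with n <? blockSize h
  ... | yes _ = All.map ℕ.m<n⇒m<1+n (letters-word h _ n)
  ... | no  _ = All.++⁺ (All.map ℕ.m<n⇒m<1+n (letters-word h _ (fullLength h)))
                        (separator<4+h ∷ All.map ℕ.m<n⇒m<1+n (letters-word h _ (n ∸ blockSize h)))
    where
    separator<4+h : toℕ (separator h<H) < 4 + h
    separator<4+h = s≤s (ℕ.≤-reflexive (toℕ-separator h<H))

  separator∉word : ∀ {h} (h<H : h < H) n → separator h<H ∉ word h (ℕ.<⇒≤ h<H) n
  separator∉word {h} h<H n sep∈ =
    ℕ.<-irrefl (toℕ-separator h<H) (All.lookup (letters-word h (ℕ.<⇒≤ h<H) n) sep∈)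

  length-word : ∀ h h≤H n → n < blockSize h → length (word h h≤H n) ≡ n
  length-word zero _ n _ with n ℕ.≟ 11
  ... | yes refl = refl
  ... | no  _    = length-replicate n
  length-word (suc h) h<H n n< with n <? blockSize h
  ... | yes n<′ = length-word h _ n n<′
  ... | no  n≮  = begin
    length (word h _ (fullLength h) ++ separator h<H ∷ word h _ (n ∸ blockSize h))
      ≡⟨ length-++ (word h _ (fullLength h)) ⟩
    length (word h _ (fullLength h)) + suc (length (word h _ (n ∸ blockSize h)))
      ≡⟨ cong₂ (λ l r → l + suc r) (length-word h _ (fullLength h) ℕ.≤-refl)
                                   (length-word h _ (n ∸ blockSize h) (remainder<blockSize h n<)) ⟩
    fullLength h + suc (n ∸ blockSize h)
      ≡⟨ ℕ.+-suc (fullLength h) _ ⟩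
    blockSize h + (n ∸ blockSize h)
      ≡⟨ ℕ.m+[n∸m]≡n (ℕ.≮⇒≥ n≮) ⟩
    n ∎
    where open ≡-Reasoning

  manyShortestCovers-word : ∀ h h≤H n → n < blockSize h →
                            ∃ λ m → ManyShortestCovers (word h h≤H n) m (2 ^ (suc n / 12))
  manyShortestCovers-word zero _ n n<12 with n ℕ.≟ 11
  ... | yes refl = 6 , manyShortestCovers-gadget
  manyShortestCovers-word zero _ zero    _    | no _ = 0 , manyShortestCovers-[]
  manyShortestCovers-word zero _ (suc n) n<12 | no n≢11 =
    1 , subst (ManyShortestCovers _ 1) (cong (2 ^_) (sym (m<n⇒m/n≡0 2+n<12))) (manyShortestCovers-replicate n)
    where
    2+n<12 : 2 + n < 12
    2+n<12 = s≤s (ℕ.≤∧≢⇒< (ℕ.≤-pred n<12) n≢11)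
  manyShortestCovers-word (suc h) h<H n n< with n <? blockSize h
  ... | yes n<′ = manyShortestCovers-word h _ n n<′
  ... | no  n≮  =
    let mₗ , left  = manyShortestCovers-word h _ (fullLength h) ℕ.≤-refl
        mᵣ , right = manyShortestCovers-word h _ (n ∸ blockSize h) (remainder<blockSize h n<)
    in mₗ + suc mᵣ ,
       subst (ManyShortestCovers _ _) (sym count≡)
             (manyShortestCovers-separated (separator∉word h<H _) (separator∉word h<H _) left right)
    where
    count≡ : 2 ^ (suc n / 12) ≡ 2 ^ (blockSize h / 12) * 2 ^ (suc (n ∸ blockSize h) / 12)
    count≡ = trans (cong (2 ^_) (suc-/-split 12 (12∣blockSize h) (ℕ.≮⇒≥ n≮)))
                   (ℕ.^-distribˡ-+-* 2 (blockSize h / 12) (suc (n ∸ blockSize h) / 12))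

theorem6 : Σ ℕ λ c → ∀ (n : ℕ) → 1 ≤ n →
    Σ ℕ λ k → (k ≤ c * (1 + ⌊log₂ n ⌋)) ×
      Σ (Word k) λ S → (length S ≡ n) ×
        Σ (List (Word k)) λ Cs → Unique Cs ×
          All (λ C → IsShortestSCover C S) Cs ×
          (2 ^ ((n + 1) / 16) ≤ length Cs)
theorem6 = 3 , λ n 1≤n →
  let t , 2^t≤n , n<2^[1+t] = binaryMagnitude n 1≤n
      open Construction t
      n<blockSize = ℕ.<-≤-trans n<2^[1+t] (2^[1+h]≤blockSize t)
      _ , 𝒮 = manyShortestCovers-word t ℕ.≤-refl n n<blockSize
  in K , 3+t≤3*[1+L] (2^t≤n⇒t≤⌊log₂n⌋ 2^t≤n) ,
     word t ℕ.≤-refl n , length-word t ℕ.≤-refl n n<blockSize ,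
     covers 𝒮 , unique 𝒮 , manyShortestCovers⇒isShortestSCover 𝒮 ,
     ℕ.≤-trans (2^[[n+1]/16]≤2^[[1+n]/12] n) (count 𝒮)
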